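{- Let $g$ be a non-empty list of natural numbers with $0$ not occurring in $g$, and let $M$ be the submonoid of $(\mathbb{N},+)$ generated by the elements of $g$ (the set of all finite $\mathbb{N}$-linear combinations of elements of $g$). Then for every $d \in M$ there exists $n \in \mathbb{N}$ with $\mathrm{mgen}_g(n) = d$.
   Context: For $m \in \mathbb{N}$, $\mathrm{next}_m$ on lists of naturals is defined by: $\mathrm{next}_m([\,]) = [0]$; $\mathrm{next}_m(h :: t) = (h+1) :: t$ if $h < m$; if $h \ge m$: $\mathrm{next}_m(h :: t) = [\,]$ when $\mathrm{next}_m(t) = [\,]$, and $=x :: x :: t'$ when $\mathrm{next}_m(t) = x :: t'$. $\mathrm{lgen}_m(0) = [\,]$, $\mathrm{lgen}_m(x+1) = \mathrm{next}_m(\mathrm{lgen}_m(x))$. For a list $g$, $g[i]$ is its $i$-th element (indexing from $0$) and $|g|$ its length. Define $\mathrm{mgen}_g(n) = \sum_{i \in \mathrm{lgen}_{|g|-1}(n)} g[i]$, where the sum runs over the elements of the list $\mathrm{lgen}_{|g|-1}(n)$ counted with multiplicity. -}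

module Defs where

open import Data.Nat using (ℕ; zero; suc; _+_; _∸_; _<ᵇ_)
open import Data.Bool using (true; false)
open import Data.List using (List; []; _∷_; length; map)
open import Data.Nat.ListAction using (sum)
open import Data.List.Membership.Propositional using (_∈_)

next : ℕ → List ℕ → List ℕ
next m [] = 0 ∷ []
next m (h ∷ t) with h <ᵇ m
... | true = suc h ∷ t
... | false with next m t
...   | [] = []
...   | x ∷ t' = x ∷ x ∷ t'

lgen : ℕ → ℕ → List ℕ
lgen m zero = []
lgen m (suc x) = next m (lgen m x)

-- g[i], i-th element (from 0); default 0 out of range (never used: the
-- entries of lgen_{|g|-1} are always < |g| when g is non-empty)
nth : List ℕ → ℕ → ℕ
nth [] i = 0
nth (x ∷ g) zero = x
nth (x ∷ g) (suc i) = nth g i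

mgen : List ℕ → ℕ → ℕ
mgen g n = sum (map (nth g) (lgen (length g ∸ 1) n))

data InSubmonoid (g : List ℕ) : ℕ → Set where
  zero-mem : InSubmonoid g 0
  gen-mem  : ∀ {a} → a ∈ g → InSubmonoid g a
  add-mem  : ∀ {a b} → InSubmonoid g a → InSubmonoid g b → InSubmonoid g (a + b)

{-# OPTIONS --safe #-}
module Submission where

-- The lists lgen_m(0), lgen_m(1), … run through every non-increasing list with
-- entries ≤ m.  Reachability from [] is proved by induction on the list: once
-- x ∷ t is reachable, each step of the run to it can be replayed on lists whose
-- head is doubled (raise the first copy to m, then step), which reaches
-- x ∷ x ∷ t, and raising the head from x to h ≥ x reaches h ∷ x ∷ t.  An
-- element of the submonoid generated by g is Σ g[i] over some list of indices
-- below |g|; sorting that list decreasingly makes it one of the lgen_{|g|-1}(n).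

open import Defs
open import Data.Nat
  using (ℕ; suc; _+_; _∸_; _<ᵇ_; _≤_; _<_; _≥_; _≤′_; z≤n; s≤s; ≤′-refl; ≤′-step)
open import Data.Bool using (true; false)
open import Data.Unit using (tt)
open import Data.Nat.Properties
  using (+-identityʳ; ≤-refl; <⇒≤; ≤⇒≯; ≰⇒>; _≤?_; ≤⇒≤′; <ᵇ⇒<; <⇒<ᵇ; <⇒≤pred; ≤-decTotalOrder)
open import Data.Nat.ListAction using (sum)
open import Data.Nat.ListAction.Properties using (sum-++; sum-↭)
open import Data.List using (List; []; _∷_; _++_; length; map)
open import Data.List.Properties using (map-++)
open import Data.List.Relation.Unary.All as All using (All; []; _∷_)
open import Data.List.Relation.Unary.All.Properties using (++⁺)
open import Data.List.Relation.Unary.Any using (here; there)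
open import Data.List.Relation.Unary.Linked using (Linked; []; [-]; _∷_)
open import Data.List.Relation.Binary.Permutation.Propositional using (↭-sym)
open import Data.List.Relation.Binary.Permutation.Propositional.Properties
  using (All-resp-↭; map⁺)
open import Data.List.Membership.Propositional using (_∈_; _∉_)
open import Relation.Binary.Properties.DecTotalOrder ≤-decTotalOrder
  using (≥-decTotalOrder)
open import Data.List.Sort ≥-decTotalOrder using (sort; sort-↭; sort-↗)
open import Data.Product using (∃; _×_; _,_)
open import Relation.Binary.Construct.Closure.ReflexiveTransitive
  using (Star; ε; _◅_; _◅◅_; return)
open import Relation.Binary.PropositionalEquality
  using (_≡_; _≢_; refl; cong; cong₂; trans; module ≡-Reasoning)
open import Relation.Nullary using (yes; no; contradiction)

dupHead : List ℕ → List ℕ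
dupHead []      = []
dupHead (x ∷ t) = x ∷ x ∷ t

module Enumeration (m : ℕ) where

  Step : List ℕ → List ℕ → Set
  Step a b = next m a ≡ b

  Reach : List ℕ → List ℕ → Set
  Reach = Star Step

  next-< : ∀ {h} t → h < m → next m (h ∷ t) ≡ suc h ∷ t
  next-< {h} t h<m with h <ᵇ m | <⇒<ᵇ h<m
  ... | true  | _ = refl

  next-≥ : ∀ {h} t → m ≤ h → next m (h ∷ t) ≡ dupHead (next m t)
  next-≥ {h} t m≤h with h <ᵇ m | <ᵇ⇒< h m
  ... | true  | <ᵇ⇒h<m = contradiction (<ᵇ⇒h<m tt) (≤⇒≯ m≤h)
  ... | false | _ with next m t
  ...   | []     = refl
  ...   | x ∷ t′ = refl

  climb : ∀ {x y} t → x ≤ y → y ≤ m → Reach (x ∷ t) (y ∷ t)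
  climb t x≤y = go (≤⇒≤′ x≤y)
    where
    go : ∀ {x y} → x ≤′ y → y ≤ m → Reach (x ∷ t) (y ∷ t)
    go ≤′-refl        _    = ε
    go (≤′-step x≤′y) y<m = go x≤′y (<⇒≤ y<m) ◅◅ return (next-< t y<m)

  dupHead-step : ∀ t → Reach (dupHead t) (dupHead (next m t))
  dupHead-step [] = refl ◅ climb [] z≤n ≤-refl ◅◅ return (next-≥ [] ≤-refl)
  dupHead-step (x ∷ t) with x ≤? m
  ... | yes x≤m = climb (x ∷ t) x≤m ≤-refl ◅◅ return (next-≥ (x ∷ t) ≤-refl)
  ... | no  x≰m = return (next-≥ (x ∷ t) (<⇒≤ (≰⇒> x≰m)))

  dupHead-reach : ∀ {a b} → Reach a b → Reach (dupHead a) (dupHead b)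
  dupHead-reach ε          = ε
  dupHead-reach (refl ◅ r) = dupHead-step _ ◅◅ dupHead-reach r

  reach-non-increasing : ∀ {l} → Linked _≥_ l → All (_≤ m) l → Reach [] l
  reach-non-increasing []         []          = ε
  reach-non-increasing [-]        (h≤m ∷ [])  = refl ◅ climb [] z≤n h≤m
  reach-non-increasing {h ∷ x ∷ t} (x≤h ∷ l↘) (h≤m ∷ l≤m) =
    dupHead-reach (reach-non-increasing l↘ l≤m) ◅◅ climb (x ∷ t) x≤h h≤m

  reach⇒lgen : ∀ {k l} → Reach (lgen m k) l → ∃ λ n → lgen m n ≡ l
  reach⇒lgen {k} ε          = k , refl
  reach⇒lgen {k} (refl ◅ r) = reach⇒lgen {suc k} r

  lgen-complete : ∀ {l} → Linked _≥_ l → All (_≤ m) l → ∃ λ n → lgen m n ≡ l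
  lgen-complete l↘ l≤m = reach⇒lgen {0} (reach-non-increasing l↘ l≤m)

∈⇒nth : ∀ {a} g → a ∈ g → ∃ λ i → i < length g × nth g i ≡ a
∈⇒nth (x ∷ g) (here refl) = 0 , s≤s z≤n , refl
∈⇒nth (x ∷ g) (there a∈g) with ∈⇒nth g a∈g
... | i , i<|g| , gᵢ≡a = suc i , s≤s i<|g| , gᵢ≡a

IndexSum : List ℕ → ℕ → List ℕ → Set
IndexSum g d is = All (_< length g) is × sum (map (nth g) is) ≡ d

indexSum-++ : ∀ {g a b is js} →
              IndexSum g a is → IndexSum g b js → IndexSum g (a + b) (is ++ js)
indexSum-++ {g} {a} {b} {is} {js} (is<|g| , Σis) (js<|g| , Σjs) =
  ++⁺ is<|g| js<|g| , (begin
    sum (map (nth g) (is ++ js))                   ≡⟨ cong sum (map-++ (nth g) is js) ⟩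
    sum (map (nth g) is ++ map (nth g) js)         ≡⟨ sum-++ (map (nth g) is) _ ⟩
    sum (map (nth g) is) + sum (map (nth g) js)    ≡⟨ cong₂ _+_ Σis Σjs ⟩
    a + b                                          ∎)
  where open ≡-Reasoning

InSubmonoid⇒indexSum : ∀ {g d} → InSubmonoid g d → ∃ (IndexSum g d)
InSubmonoid⇒indexSum zero-mem = [] , [] , refl
InSubmonoid⇒indexSum {g} (gen-mem a∈g) with ∈⇒nth g a∈g
... | i , i<|g| , gᵢ≡a = i ∷ [] , i<|g| ∷ [] , trans (+-identityʳ _) gᵢ≡a
InSubmonoid⇒indexSum {g} (add-mem a∈M b∈M)
  with InSubmonoid⇒indexSum a∈M | InSubmonoid⇒indexSum b∈M
... | is , rep-a | js , rep-b = is ++ js , indexSum-++ {g} rep-a rep-b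

sort-indexSum : ∀ {g d is} → IndexSum g d is → IndexSum g d (sort is)
sort-indexSum {g} {is = is} (is<|g| , Σis) =
  All-resp-↭ (↭-sym (sort-↭ is)) is<|g| , trans (sum-↭ (map⁺ (nth g) (sort-↭ is))) Σis

theorem8 : (g : List ℕ) → g ≢ [] → 0 ∉ g →
           (d : ℕ) → InSubmonoid g d → ∃ λ n → mgen g n ≡ d
theorem8 g _ _ d d∈M =
  let is , rep         = InSubmonoid⇒indexSum d∈M
      is<|g| , sum≡d   = sort-indexSum {g} rep
      n , lgen≡sort-is = Enumeration.lgen-complete (length g ∸ 1) (sort-↗ is)
                           (All.map <⇒≤pred is<|g|)
  in n , trans (cong (λ l → sum (map (nth g) l)) lgen≡sort-is) sum≡d
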